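{- Suppose that for every nonconstant polynomial $f(x)\in\mathbb{Z}[x]$ and every $\varepsilon>0$ there exist infinitely many positive integers $n$ such that $f(n)$ is $n^{\varepsilon}$-smooth. Then $\pi(\boldsymbol{p})\coloneqq(\pi(p)\bmod p)_p\in\mathcal{A}\setminus\mathcal{C}_{\mathcal{A}}$.
   Context: $\pi(X)$ is the prime counting function, so $\pi(\boldsymbol p)=(n\bmod p_n)_{p_n}$ with $p_n$ the $n$th prime. An integer is $y$-smooth if all its prime factors are at most $y$. $\mathcal{A}\coloneqq\bigl(\prod_{p}\mathbb{Z}/p\mathbb{Z}\bigr)/\bigl(\bigoplus_{p}\mathbb{Z}/p\mathbb{Z}\bigr)$ over all primes $p$, elements written $(a_p)_p$, equal iff components agree for all but finitely many primes. $\mathcal{C}_{\mathcal{A}}$ is the integral closure of $\mathbb{Q}$ (diagonally embedded) in $\mathcal{A}$; equivalently $(a_p)_p\in\mathcal{C}_{\mathcal{A}}$ iff some nonzero $f\in\mathbb{Z}[x]$ satisfies $f(a_p)=0$ in $\mathbb{Z}/p\mathbb{Z}$ for all but finitely many $p$. -}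

module Defs where

open import Data.Nat using (ℕ; zero; suc; _≤_; _<_; _^_; _%_)
open import Data.Nat.Primality using (Prime; prime?)
open import Data.Nat.Divisibility using (_∣_)
open import Data.Integer as ℤ using (ℤ; +_; ∣_∣)
open import Data.Integer.Divisibility as ℤD using ()
open import Data.List using (List; []; _∷_; length; filter; upTo)
open import Data.Product using (Σ; ∃; _×_; _,_)
open import Relation.Nullary using (¬_)
open import Data.Empty using (⊥)
open import Data.Nat.Primality using (prime⇒nonZero)
open import Relation.Binary.PropositionalEquality using (_≢_)

-- Polynomials in ℤ[x] as coefficient lists, constant term first:
-- a₀ ∷ a₁ ∷ … represents a₀ + a₁ x + a₂ x² + …
Poly : Set
Poly = List ℤ

eval : Poly → ℤ → ℤ
eval []       x = + 0
eval (a ∷ as) x = a ℤ.+ x ℤ.* eval as x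

data NonZeroPoly : Poly → Set where
  here  : ∀ {a as} → a ≢ + 0 → NonZeroPoly (a ∷ as)
  there : ∀ {a as} → NonZeroPoly as → NonZeroPoly (a ∷ as)

NonConstant : Poly → Set
NonConstant []       = ⊥
NonConstant (a ∷ as) = NonZeroPoly as

π : ℕ → ℕ
π x = length (filter prime? (upTo (suc x)))

-- An integer m is y-smooth with y = n^(a/b) (b ≥ 1): every prime factor q of m
-- satisfies q ≤ n^(a/b), i.e. q^b ≤ n^a.
SmoothPow : ℕ → ℕ → ℕ → ℤ → Set
SmoothPow n a b m = ∀ q → Prime q → q ∣ ∣ m ∣ → q ^ b ≤ n ^ a

SmoothHypothesis : Set
SmoothHypothesis =
  (f : Poly) → NonConstant f →
  (a b : ℕ) → 1 ≤ a → 1 ≤ b →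
  (M : ℕ) → ∃ λ n → M < n × 1 ≤ n × SmoothPow n a b (eval f (+ n))

-- Membership in C_A of the element (a_p)_p of A, given by a function
-- a : (p : ℕ) → Prime p → ℕ (component at p, read in ℤ/pℤ):
-- some nonzero f ∈ ℤ[x] has f(a_p) ≡ 0 mod p for all but finitely many primes p.
InC : ((p : ℕ) → Prime p → ℕ) → Set
InC a = Σ Poly λ f → NonZeroPoly f × ∃ λ N →
          ∀ p (pp : Prime p) → N < p → (+ p) ℤD.∣ eval f (+ (a p pp))

πp : (p : ℕ) → Prime p → ℕ
πp p pp = π p % p
  where instance _ = prime⇒nonZero pp

{-# OPTIONS --safe #-}
-- If f(π(p)) ≡ 0 (mod p) for all large primes p, then for every large n the
-- n-th prime p, which exceeds n, divides f(n).  So n·f(n) has a prime factor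
-- greater than n, which for infinitely many n is ruled out by the smoothness
-- hypothesis for the nonconstant polynomial x·f(x) and ε = 1.
module Submission where

open import Defs
open import Relation.Nullary using (¬_; yes; no; contradiction)
open import Data.Nat as ℕ
  using (ℕ; zero; suc; _+_; _*_; _≤_; _<_; _≤′_; _!; z≤n; s≤s; z<s; _≤?_)
open import Data.Nat.Properties
open import Data.Nat.Divisibility using (_∣_; ∣-trans; m∣m*n; ∣n⇒∣m*n; m≤n⇒m!∣n!; ∣m+n∣m⇒∣n; ∣1⇒≡1)
open import Data.Nat.DivMod using (m<n⇒m%n≡m)
open import Data.Nat.Primality using (Prime; prime?; prime⇒nonZero; prime⇒nonTrivial)
open import Data.Nat.Primality.Factorisation using (factorise)
open import Data.Integer as ℤ using (+_; ∣_∣)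
import Data.Integer.Properties as ℤ
open import Data.List using ([]; _∷_; length; filter; upTo; _++_)
open import Data.List.Properties using (upTo-∷ʳ; filter-++; length-++; filter-accept; filter-reject)
open import Data.List.Relation.Unary.All using (_∷_)
open import Data.Product using (∃; _×_; _,_)
open import Relation.Binary.PropositionalEquality

prime⇒positive : ∀ {p} → Prime p → 0 < p
prime⇒positive {p} pp = ℕ.>-nonZero⁻¹ p {{prime⇒nonZero pp}}

∣n! : ∀ {m n} → 0 < m → m ≤ n → m ∣ n !
∣n! {suc m} _ m≤n = ∣-trans (m∣m*n (m !)) (m≤n⇒m!∣n! m≤n)

-- Euclid: every prime factor of n! + 1 exceeds n.
∃prime> : ∀ n → ∃ λ p → Prime p × n < p
∃prime> n with factorise (suc (n !))
... | record { factors = [] ; isFactorisation = ∏≡ } =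
  contradiction (suc-injective ∏≡) (ℕ.≢-nonZero⁻¹ (n !) {{n !≢0}})
... | record { factors = p ∷ ps ; isFactorisation = ∏≡ ; factorsPrime = pp ∷ _ } with n <? p
...   | yes n<p = p , pp , n<p
...   | no  n≮p = contradiction (∣1⇒≡1 p∣1) p≢1
  where
    p∣1 : p ∣ 1
    p∣1 = ∣m+n∣m⇒∣n (subst (p ∣_) (trans (sym ∏≡) (+-comm 1 (n !))) (m∣m*n _))
                    (∣n! (prime⇒positive pp) (≮⇒≥ n≮p))
    p≢1 : ¬ p ≡ 1
    p≢1 refl = ℕ.NonTrivial.nonTrivial (prime⇒nonTrivial pp)

crossing : ∀ (f : ℕ → ℕ) {m} n → f 0 < m → m ≤ f n → ∃ λ k → f k < m × m ≤ f (suc k)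
crossing f zero    f0<m m≤f0 = contradiction m≤f0 (<⇒≱ f0<m)
crossing f (suc n) f0<m m≤fn₊₁ with _ ≤? f n
... | yes m≤fn = crossing f n f0<m m≤fn
... | no  m≰fn = n , ≰⇒> m≰fn , m≤fn₊₁

π-suc : ∀ n → π (suc n) ≡ π n + length (filter prime? (suc n ∷ []))
π-suc n = begin
  length (filter prime? (upTo (suc (suc n))))
    ≡⟨ cong (λ l → length (filter prime? l)) (upTo-∷ʳ (suc n)) ⟨
  length (filter prime? (upTo (suc n) ++ suc n ∷ []))
    ≡⟨ cong length (filter-++ prime? (upTo (suc n)) (suc n ∷ [])) ⟩
  length (filter prime? (upTo (suc n)) ++ filter prime? (suc n ∷ []))
    ≡⟨ length-++ (filter prime? (upTo (suc n))) ⟩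
  π n + length (filter prime? (suc n ∷ []))
    ∎
  where open ≡-Reasoning

π-suc-prime : ∀ {n} → Prime (suc n) → π (suc n) ≡ suc (π n)
π-suc-prime {n} pp = begin
  π (suc n)                                 ≡⟨ π-suc n ⟩
  π n + length (filter prime? (suc n ∷ [])) ≡⟨ cong (λ l → π n + length l) (filter-accept prime? pp) ⟩
  π n + 1                                   ≡⟨ +-comm (π n) 1 ⟩
  suc (π n)                                 ∎
  where open ≡-Reasoning

π-suc-¬prime : ∀ {n} → ¬ Prime (suc n) → π (suc n) ≡ π n
π-suc-¬prime {n} ¬pp = begin
  π (suc n)                                 ≡⟨ π-suc n ⟩
  π n + length (filter prime? (suc n ∷ [])) ≡⟨ cong (λ l → π n + length l) (filter-reject prime? ¬pp) ⟩
  π n + 0                                   ≡⟨ +-identityʳ (π n) ⟩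
  π n                                       ∎
  where open ≡-Reasoning

π[1+n]≤1+π[n] : ∀ n → π (suc n) ≤ suc (π n)
π[1+n]≤1+π[n] n with prime? (suc n)
... | yes pp = ≤-reflexive (π-suc-prime pp)
... | no ¬pp = ≤-trans (≤-reflexive (π-suc-¬prime ¬pp)) (n≤1+n (π n))

π[n]≤π[1+n] : ∀ n → π n ≤ π (suc n)
π[n]≤π[1+n] n with prime? (suc n)
... | yes pp = ≤-trans (n≤1+n (π n)) (≤-reflexive (sym (π-suc-prime pp)))
... | no ¬pp = ≤-reflexive (sym (π-suc-¬prime ¬pp))

π-mono-≤ : ∀ {m n} → m ≤ n → π m ≤ π n
π-mono-≤ m≤n = go (≤⇒≤′ m≤n)
  where
    go : ∀ {m n} → m ≤′ n → π m ≤ π n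
    go ℕ.≤′-refl             = ≤-refl
    go (ℕ.≤′-step {n} m≤′n) = ≤-trans (go m≤′n) (π[n]≤π[1+n] n)

π[1+n]<1+n : ∀ n → π (suc n) < suc n
π[1+n]<1+n zero    = z<s
π[1+n]<1+n (suc n) = s≤s (≤-trans (π[1+n]≤1+π[n] (suc n)) (π[1+n]<1+n n))

π-unbounded : ∀ m → ∃ λ n → m ≤ π n
π-unbounded zero = 0 , z≤n
π-unbounded (suc m) with π-unbounded m
... | n , m≤πn with ∃prime> n
...   | suc p , pp , n<1+p = suc p , (begin
  suc m          ≤⟨ s≤s m≤πn ⟩
  suc (π n)      ≤⟨ s≤s (π-mono-≤ (ℕ.s≤s⁻¹ n<1+p)) ⟩
  suc (π p)      ≡⟨ π-suc-prime pp ⟨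
  π (suc p)      ∎)
  where open ≤-Reasoning

-- π grows by steps of at most one, so it hits every m ≥ 1, necessarily at a prime.
π-surjective : ∀ {m} → 0 < m → ∃ λ p → Prime p × π p ≡ m
π-surjective {m} 0<m with π-unbounded m
... | n , m≤πn with crossing π n 0<m m≤πn
...   | k , πk<m , m≤π[1+k] with prime? (suc k)
...     | yes pp  = suc k , pp , ≤-antisym (≤-trans (≤-reflexive (π-suc-prime pp)) πk<m) m≤π[1+k]
...     | no  ¬pp = contradiction (subst (m ≤_) (π-suc-¬prime ¬pp) m≤π[1+k]) (<⇒≱ πk<m)

π[n]<n : ∀ {n} → 0 < n → π n < n
π[n]<n {suc n} _ = π[1+n]<1+n n

πp≡π : ∀ {p} (pp : Prime p) → πp p pp ≡ π p
πp≡π {suc p} _ = m<n⇒m%n≡m (π[1+n]<1+n p)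

∣eval-x*f∣ : ∀ f x → ∣ eval (+ 0 ∷ f) x ∣ ≡ ∣ x ∣ * ∣ eval f x ∣
∣eval-x*f∣ f x = trans (cong ∣_∣ (ℤ.+-identityˡ (x ℤ.* eval f x))) (ℤ.abs-* x (eval f x))

smooth₁⇒factor≤ : ∀ {n} m → SmoothPow n 1 1 m → ∀ {q} → Prime q → q ∣ ∣ m ∣ → q ≤ n
smooth₁⇒factor≤ {n} _ smooth {q} qq q∣m = subst₂ _≤_ (*-identityʳ q) (*-identityʳ n) (smooth q qq q∣m)

proposition6p5 : SmoothHypothesis → ¬ InC πp
proposition6p5 H (f , f≢0 , N , f[πp]≡0) with H (+ 0 ∷ f) f≢0 1 1 ≤-refl ≤-refl N
... | n , N<n , 0<n , smooth with π-surjective 0<n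
...   | p , pp , refl = contradiction p≤πp (<⇒≱ πp<p)
  where
    πp<p : π p < p
    πp<p = π[n]<n (prime⇒positive pp)

    p∣f[πp] : p ∣ ∣ eval f (+ π p) ∣
    p∣f[πp] = subst (λ k → p ∣ ∣ eval f (+ k) ∣) (πp≡π pp) (f[πp]≡0 p pp (<-trans N<n πp<p))

    p∣πp*f[πp] : p ∣ ∣ eval (+ 0 ∷ f) (+ π p) ∣
    p∣πp*f[πp] = subst (p ∣_) (sym (∣eval-x*f∣ f (+ π p))) (∣n⇒∣m*n (π p) p∣f[πp])

    p≤πp : p ≤ π p
    p≤πp = smooth₁⇒factor≤ (eval (+ 0 ∷ f) (+ π p)) smooth pp p∣πp*f[πp]
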